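{- For nonnegative integers $n_1,n_2,a,b$, and $n=n_1+n_2$, we have \begin{multline*} \sum_{i,j\ge0} q^{(n_1-a)i+(n_2-b)j-ij+i^2+j^2} \binom{n_1}{a-i}_q\binom{n_2}{b-j}_q \binom{n_1+n_2}{n_1+i-j}_q \binom{n_1+i}{n_1}_q \binom{n_2+j}{n_2}_q\\ = \binom{n}{n_1}_q\sum_{i\ge0} q^{(n-a-b)i + i^2} \binom{n+i}{i}_q \binom{n}{a-i}_q \binom{n}{b-i}_q. \end{multline*}
   Context: Here $[m]_q=1+q+\cdots+q^{m-1}$, $[m]_q!=[1]_q\cdots[m]_q$, and $\binom{m}{j}_q=\frac{[m]_q!}{[j]_q![m-j]_q!}$ is the $q$-binomial coefficient (zero if $j<0$ or $j>m$). -}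

module Defs where

open import Level using (Level)
open import Algebra.Bundles using (CommutativeRing)
open import Data.Nat using (ℕ; zero; suc; _⊓_)
import Data.Nat as N
import Data.Integer as Z
open import Data.Integer using (ℤ; +_; -[1+_])

module QDefs {c ℓ : Level} (R : CommutativeRing c ℓ) where
  open CommutativeRing R hiding (zero)

  pow : Carrier → ℕ → Carrier
  pow x zero    = 1#
  pow x (suc n) = x * pow x n

  zpow : (q qinv : Carrier) → ℤ → Carrier
  zpow q qinv (+ n)      = pow q n
  zpow q qinv -[1+ n ]   = pow qinv (suc n)

  -- q-binomial coefficient [m choose k]_q, via the q-Pascal recurrence
  -- [m+1 choose k+1] = [m choose k] + q^(k+1) [m choose k+1];
  -- it is zero when k > m.
  qbinom : Carrier → ℕ → ℕ → Carrier
  qbinom q m       zero    = 1#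
  qbinom q zero    (suc k) = 0#
  qbinom q (suc m) (suc k) = qbinom q m k + pow q (suc k) * qbinom q m (suc k)

  qbinomℤ : Carrier → ℕ → ℤ → Carrier
  qbinomℤ q m (+ k)    = qbinom q m k
  qbinomℤ q m -[1+ k ] = 0#

  -- Σ_{i=0}^{N} f i  (inclusive upper bound)
  sumTo : ℕ → (ℕ → Carrier) → Carrier
  sumTo zero    f = f zero
  sumTo (suc N) f = sumTo N f + f (suc N)

  -- Left-hand side of Proposition 5.1: Σ_{i,j ≥ 0}, truncated to 0 ≤ i ≤ a, 0 ≤ j ≤ b
  -- (all other terms vanish because [n₁ choose a-i]_q = 0 for i > a, etc.)
  lhs5p1 : (q qinv : Carrier) (n₁ n₂ a b : ℕ) → Carrier
  lhs5p1 q qinv n₁ n₂ a b =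
    sumTo a (λ i → sumTo b (λ j →
      zpow q qinv ((+ n₁ Z.- + a) Z.* + i Z.+ (+ n₂ Z.- + b) Z.* + j
                   Z.- + i Z.* + j Z.+ + i Z.* + i Z.+ + j Z.* + j)
      * (qbinomℤ q n₁ (+ a Z.- + i)
      * (qbinomℤ q n₂ (+ b Z.- + j)
      * (qbinomℤ q (n₁ N.+ n₂) (+ n₁ Z.+ + i Z.- + j)
      * (qbinom q (n₁ N.+ i) n₁
      * qbinom q (n₂ N.+ j) n₂))))))

  -- Right-hand side: [n choose n₁]_q Σ_{i ≥ 0}, truncated to 0 ≤ i ≤ min(a,b)
  rhs5p1 : (q qinv : Carrier) (n₁ n₂ a b : ℕ) → Carrier
  rhs5p1 q qinv n₁ n₂ a b =
    qbinom q n n₁ * sumTo (a ⊓ b) (λ i →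
      zpow q qinv ((+ n Z.- + a Z.- + b) Z.* + i Z.+ + i Z.* + i)
      * (qbinom q (n N.+ i) i
      * (qbinomℤ q n (+ a Z.- + i)
      * qbinomℤ q n (+ b Z.- + i))))
    where n = n₁ N.+ n₂

module Submission where

-- Idea.  Write [m,k] for the q-binomial coefficient, extended by zero to
-- negative lower index.  The heart of the argument is the expansion
--
--   [n₁+i, j] [n₂+j, i] = Σ_k q^{(i-k)(j-k)} [n₁+n₂+k, k] [n₂, i-k] [n₁, j-k],   (★)
--
-- proved by induction on n₁, i, j from the q-Pascal rules.  Combined with the
-- symmetry of the q-multinomial coefficient it turns the product
-- [n, n₁+i-j] [n₁+i, n₁] [n₂+j, n₂] of the left-hand side into [n, n₁] times a
-- sum over k.  After moving k to the outside, the sums over i and over j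
-- separate and each is a q-Vandermonde convolution, giving [n, a-k] and
-- [n, b-k]; the result is the right-hand side.

open import Defs
open import Algebra.Bundles using (CommutativeRing)
open import Data.Nat as N using (ℕ; zero; suc; _⊓_; _≤_; _<_; z≤n; s≤s)
import Data.Nat.Properties as NP
import Data.Integer as Z
open import Data.Integer using (ℤ; +_; -[1+_])
import Data.Integer.Properties as ZP
open import Relation.Binary.PropositionalEquality as P using (_≡_; _≢_)
open import Relation.Binary.Definitions using (Tri)
open import Relation.Nullary using (yes; no)
open import Data.Empty using (⊥-elim)
import Data.Integer.Tactic.RingSolver as ZS
import Data.Nat.Tactic.RingSolver as NS
import Relation.Binary.Reasoning.Setoid as SetoidReasoning
import Algebra.Solver.Ring.NaturalCoefficients.Default as NatCoeffSolver

module Sums {c ℓ} (R : CommutativeRing c ℓ) where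
  open CommutativeRing R hiding (zero)
  open QDefs R using (sumTo)
  open SetoidReasoning setoid
  open NatCoeffSolver commutativeSemiring

  absorbˡ : ∀ {x y} → x ≈ 0# → x * y ≈ 0#
  absorbˡ h = trans (*-congʳ h) (zeroˡ _)

  absorbʳ : ∀ {x y} → y ≈ 0# → x * y ≈ 0#
  absorbʳ h = trans (*-congˡ h) (zeroʳ _)

  sum-cong : ∀ N {f g : ℕ → Carrier} → (∀ k → k ≤ N → f k ≈ g k) → sumTo N f ≈ sumTo N g
  sum-cong zero h = h 0 z≤n
  sum-cong (suc N) h = +-cong (sum-cong N (λ k k≤N → h k (NP.m≤n⇒m≤1+n k≤N))) (h (suc N) NP.≤-refl)

  sum-+ : ∀ N (f g : ℕ → Carrier) → sumTo N (λ k → f k + g k) ≈ sumTo N f + sumTo N g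
  sum-+ zero f g = refl
  sum-+ (suc N) f g = begin
    sumTo N (λ k → f k + g k) + (f (suc N) + g (suc N)) ≈⟨ +-congʳ (sum-+ N f g) ⟩
    (sumTo N f + sumTo N g) + (f (suc N) + g (suc N))
      ≈⟨ solve 4 (λ a b c d → ((a :+ b) :+ (c :+ d)) := ((a :+ c) :+ (b :+ d))) refl _ _ _ _ ⟩
    (sumTo N f + f (suc N)) + (sumTo N g + g (suc N)) ∎

  sum-*ˡ : ∀ N x (f : ℕ → Carrier) → x * sumTo N f ≈ sumTo N (λ k → x * f k)
  sum-*ˡ zero x f = refl
  sum-*ˡ (suc N) x f = trans (distribˡ x _ _) (+-congʳ (sum-*ˡ N x f))

  sum-*ʳ : ∀ N x (f : ℕ → Carrier) → sumTo N f * x ≈ sumTo N (λ k → f k * x)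
  sum-*ʳ zero x f = refl
  sum-*ʳ (suc N) x f = trans (distribʳ x _ _) (+-congʳ (sum-*ʳ N x f))

  sum-swap : ∀ A B (f : ℕ → ℕ → Carrier) →
    sumTo A (λ i → sumTo B (λ j → f i j)) ≈ sumTo B (λ j → sumTo A (λ i → f i j))
  sum-swap zero B f = refl
  sum-swap (suc A) B f = begin
    sumTo A (λ i → sumTo B (λ j → f i j)) + sumTo B (λ j → f (suc A) j) ≈⟨ +-congʳ (sum-swap A B f) ⟩
    sumTo B (λ j → sumTo A (λ i → f i j)) + sumTo B (λ j → f (suc A) j) ≈⟨ sym (sum-+ B _ _) ⟩
    sumTo B (λ j → sumTo A (λ i → f i j) + f (suc A) j) ∎

  sum-zero : ∀ N {f : ℕ → Carrier} → (∀ k → k ≤ N → f k ≈ 0#) → sumTo N f ≈ 0#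
  sum-zero zero h = h 0 z≤n
  sum-zero (suc N) h =
    trans (+-cong (sum-zero N (λ k k≤N → h k (NP.m≤n⇒m≤1+n k≤N))) (h (suc N) NP.≤-refl)) (+-identityʳ 0#)

  sum-peel : ∀ N (f : ℕ → Carrier) → sumTo (suc N) f ≈ f 0 + sumTo N (λ k → f (suc k))
  sum-peel zero f = refl
  sum-peel (suc N) f = trans (+-congʳ (sum-peel N f)) (+-assoc _ _ _)

  sum-extend : ∀ M d (f : ℕ → Carrier) → (∀ k → M < k → f k ≈ 0#) → sumTo (M N.+ d) f ≈ sumTo M f
  sum-extend M zero f h = reflexive (P.cong (λ t → sumTo t f) (NP.+-identityʳ M))
  sum-extend M (suc d) f h = begin
    sumTo (M N.+ suc d) f ≈⟨ reflexive (P.cong (λ t → sumTo t f) (NP.+-suc M d)) ⟩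
    sumTo (M N.+ d) f + f (suc (M N.+ d)) ≈⟨ +-cong (sum-extend M d f h) (h _ (s≤s (NP.m≤m+n M d))) ⟩
    sumTo M f + 0# ≈⟨ +-identityʳ _ ⟩
    sumTo M f ∎

  sum-extend≤ : ∀ M K (f : ℕ → Carrier) → M ≤ K → (∀ k → M < k → f k ≈ 0#) → sumTo K f ≈ sumTo M f
  sum-extend≤ M K f M≤K h =
    trans (reflexive (P.cong (λ t → sumTo t f) (P.sym (NP.m+[n∸m]≡n M≤K)))) (sum-extend M (K N.∸ M) f h)

  sum-shift : ∀ k M (f : ℕ → Carrier) → (∀ i → i < k → f i ≈ 0#) →
    sumTo (k N.+ M) f ≈ sumTo M (λ r → f (k N.+ r))
  sum-shift zero M f h = refl
  sum-shift (suc k) M f h = begin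
    sumTo (suc (k N.+ M)) f ≈⟨ sum-peel (k N.+ M) f ⟩
    f 0 + sumTo (k N.+ M) (λ i → f (suc i))
      ≈⟨ +-cong (h 0 (s≤s z≤n)) (sum-shift k M (λ i → f (suc i)) (λ i i<k → h (suc i) (s≤s i<k))) ⟩
    0# + sumTo M (λ r → f (suc (k N.+ r))) ≈⟨ +-identityˡ _ ⟩
    sumTo M (λ r → f (suc (k N.+ r))) ∎

  sum-single : ∀ N t (f : ℕ → Carrier) → t ≤ N → (∀ k → k ≢ t → f k ≈ 0#) → sumTo N f ≈ f t
  sum-single N t f t≤N h = begin
    sumTo N f ≈⟨ reflexive (P.cong (λ u → sumTo u f) (P.sym (NP.m+[n∸m]≡n t≤N))) ⟩
    sumTo (t N.+ (N N.∸ t)) f ≈⟨ sum-shift t (N N.∸ t) f (λ i i<t → h i (NP.<⇒≢ i<t)) ⟩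
    sumTo (N N.∸ t) (λ r → f (t N.+ r)) ≈⟨ sum-extend 0 (N N.∸ t) _ (λ { (suc r) _ → h _ (NP.m+1+n≢m t) }) ⟩
    f (t N.+ 0) ≈⟨ reflexive (P.cong f (NP.+-identityʳ t)) ⟩
    f t ∎

module QBinomialBasics {c ℓ} (R : CommutativeRing c ℓ) (q : CommutativeRing.Carrier R) where
  open CommutativeRing R hiding (zero)
  open QDefs R
  open SetoidReasoning setoid
  open NatCoeffSolver commutativeSemiring

  qb : ℕ → ℕ → Carrier
  qb = qbinom q

  qb-cong : ∀ {m m' k k'} → m ≡ m' → k ≡ k' → qb m k ≈ qb m' k'
  qb-cong P.refl P.refl = refl

  qb-cong-top : ∀ {m m'} → m ≡ m' → ∀ k → qb m k ≈ qb m' k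
  qb-cong-top e k = qb-cong e (P.refl {x = k})

  pow-+ : ∀ x m n → pow x (m N.+ n) ≈ pow x m * pow x n
  pow-+ x zero n = sym (*-identityˡ _)
  pow-+ x (suc m) n = trans (*-congˡ (pow-+ x m n)) (sym (*-assoc _ _ _))

  qb-zero : ∀ m k → m < k → qb m k ≈ 0#
  qb-zero zero (suc k) _ = refl
  qb-zero (suc m) (suc k) (s≤s m<k) = begin
    qb m k + pow q (suc k) * qb m (suc k)
      ≈⟨ +-cong (qb-zero m k m<k) (*-congˡ (qb-zero m (suc k) (NP.m<n⇒m<1+n m<k))) ⟩
    0# + pow q (suc k) * 0# ≈⟨ trans (+-identityˡ _) (zeroʳ _) ⟩
    0# ∎

  qb-diag : ∀ m → qb m m ≈ 1#
  qb-diag zero = refl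
  qb-diag (suc m) = begin
    qb m m + pow q (suc m) * qb m (suc m) ≈⟨ +-cong (qb-diag m) (*-congˡ (qb-zero m (suc m) NP.≤-refl)) ⟩
    1# + pow q (suc m) * 0# ≈⟨ trans (+-congˡ (zeroʳ _)) (+-identityʳ _) ⟩
    1# ∎

  qb-diag′ : ∀ m → qb (m N.+ 0) m ≈ 1#
  qb-diag′ m = trans (qb-cong-top (NP.+-identityʳ m) m) (qb-diag m)

  -- Trinomial revision [x+y+z, x+y] [x+y, x] = [x+y+z, x] [y+z, y]:
  -- both sides count the ways to split x+y+z into parts of sizes x, y, z.
  trinomial : ∀ x y z → qb (x N.+ y N.+ z) (x N.+ y) * qb (x N.+ y) x ≈ qb (x N.+ y N.+ z) x * qb (y N.+ z) y
  trinomial zero y z = trans (*-identityʳ _) (sym (*-identityˡ _))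
  trinomial (suc x) zero z = begin
    qb (suc x N.+ 0 N.+ z) (suc x N.+ 0) * qb (suc x N.+ 0) (suc x)
      ≈⟨ *-cong (qb-cong (P.cong (N._+ z) x+0) x+0) (qb-diag′ (suc x)) ⟩
    qb (suc x N.+ z) (suc x) * 1# ≈⟨ *-congʳ (qb-cong-top (P.cong (N._+ z) (P.sym x+0)) (suc x)) ⟩
    qb (suc x N.+ 0 N.+ z) (suc x) * 1# ∎
    where
    x+0 = NP.+-identityʳ (suc x)
  trinomial (suc x) (suc y) zero = begin
    qb (s N.+ 0) s * qb s (suc x) ≈⟨ *-congʳ (qb-diag′ s) ⟩
    1# * qb s (suc x) ≈⟨ trans (*-identityˡ _) (sym (*-identityʳ _)) ⟩
    qb s (suc x) * 1# ≈⟨ *-cong (qb-cong-top (P.sym (NP.+-identityʳ s)) (suc x)) (sym (qb-diag′ (suc y))) ⟩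
    qb (s N.+ 0) (suc x) * qb (suc y N.+ 0) (suc y) ∎
    where
    s = suc x N.+ suc y
  trinomial (suc x) (suc y) (suc z) = begin
    (a₁ + pow q (suc (x N.+ suc y)) * a₂) * (b₁ + pow q (suc x) * b₂)
      ≈⟨ solve 6 (λ a₁ a₂ b₁ b₂ p r → ((a₁ :+ p :* a₂) :* (b₁ :+ r :* b₂))
                   := (a₁ :* b₁ :+ r :* (a₁ :* b₂) :+ p :* (a₂ :* (b₁ :+ r :* b₂))))
                 refl a₁ a₂ b₁ b₂ (pow q (suc (x N.+ suc y))) (pow q (suc x)) ⟩
    a₁ * b₁ + pow q (suc x) * (a₁ * b₂) + pow q (suc (x N.+ suc y)) * (a₂ * qb (suc x N.+ suc y) (suc x))
      ≈⟨ +-cong (+-cong (trinomial x (suc y) (suc z)) (*-congˡ middle)) (*-cong (pow-+ q (suc x) (suc y)) last) ⟩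
    qb T x * qb (suc y N.+ suc z) (suc y)
      + pow q (suc x) * (qb T (suc x) * qb (y N.+ suc z) y)
      + (pow q (suc x) * pow q (suc y)) * (qb T (suc x) * qb (y N.+ suc z) (suc y))
      ≈⟨ solve 6 (λ a c d e f g → (a :* (e :+ f :* g) :+ c :* (d :* e) :+ (c :* f) :* (d :* g))
                   := ((a :+ c :* d) :* (e :+ f :* g)))
                 refl (qb T x) (pow q (suc x)) (qb T (suc x)) (qb (y N.+ suc z) y) (pow q (suc y)) (qb (y N.+ suc z) (suc y)) ⟩
    (qb T x + pow q (suc x) * qb T (suc x)) * (qb (y N.+ suc z) y + pow q (suc y) * qb (y N.+ suc z) (suc y)) ∎
    where
    T = x N.+ suc y N.+ suc z
    a₁ = qb T (x N.+ suc y)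
    a₂ = qb T (suc (x N.+ suc y))
    b₁ = qb (x N.+ suc y) x
    b₂ = qb (x N.+ suc y) (suc x)
    xy : x N.+ suc y ≡ suc x N.+ y
    xy = NP.+-suc x y
    middle : a₁ * b₂ ≈ qb T (suc x) * qb (y N.+ suc z) y
    middle = begin
      a₁ * b₂ ≈⟨ *-cong (qb-cong (P.cong (N._+ suc z) xy) xy) (qb-cong-top xy (suc x)) ⟩
      qb (suc x N.+ y N.+ suc z) (suc x N.+ y) * qb (suc x N.+ y) (suc x) ≈⟨ trinomial (suc x) y (suc z) ⟩
      qb (suc x N.+ y N.+ suc z) (suc x) * qb (y N.+ suc z) y ≈⟨ *-congʳ (qb-cong-top (P.cong (N._+ suc z) (P.sym xy)) (suc x)) ⟩
      qb T (suc x) * qb (y N.+ suc z) y ∎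
    T≡ : T ≡ suc x N.+ suc y N.+ z
    T≡ = NP.+-suc (x N.+ suc y) z
    last : a₂ * qb (suc x N.+ suc y) (suc x) ≈ qb T (suc x) * qb (y N.+ suc z) (suc y)
    last = begin
      a₂ * qb (suc x N.+ suc y) (suc x) ≈⟨ *-congʳ (qb-cong-top T≡ (suc x N.+ suc y)) ⟩
      qb (suc x N.+ suc y N.+ z) (suc x N.+ suc y) * qb (suc x N.+ suc y) (suc x) ≈⟨ trinomial (suc x) (suc y) z ⟩
      qb (suc x N.+ suc y N.+ z) (suc x) * qb (suc y N.+ z) (suc y)
        ≈⟨ *-cong (qb-cong-top (P.sym T≡) (suc x)) (qb-cong-top (P.sym (NP.+-suc y z)) (suc y)) ⟩
      qb T (suc x) * qb (y N.+ suc z) (suc y) ∎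

module IntegerPowers {c ℓ} (R : CommutativeRing c ℓ)
  (q qinv : CommutativeRing.Carrier R)
  (q·qinv≈1 : CommutativeRing._≈_ R (CommutativeRing._*_ R q qinv) (CommutativeRing.1# R)) where

  open CommutativeRing R hiding (zero)
  open QDefs R
  open SetoidReasoning setoid

  Q : ℤ → Carrier
  Q = zpow q qinv

  Q-cong : ∀ {x y} → x ≡ y → Q x ≈ Q y
  Q-cong e = reflexive (P.cong Q e)

  Q-suc : ∀ x → Q (+ 1 Z.+ x) ≈ q * Q x
  Q-suc (+ n) = refl
  Q-suc -[1+ zero ] = begin
    1# ≈⟨ sym q·qinv≈1 ⟩ q * qinv ≈⟨ *-congˡ (sym (*-identityʳ qinv)) ⟩ q * (qinv * 1#) ∎
  Q-suc -[1+ (suc n) ] = begin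
    qinv * pow qinv n ≈⟨ sym (*-identityˡ _) ⟩
    1# * (qinv * pow qinv n) ≈⟨ *-congʳ (sym q·qinv≈1) ⟩
    (q * qinv) * (qinv * pow qinv n) ≈⟨ *-assoc q qinv _ ⟩
    q * (qinv * (qinv * pow qinv n)) ∎

  Q-pred : ∀ x → Q (-[1+ 0 ] Z.+ x) ≈ qinv * Q x
  Q-pred (+ zero) = refl
  Q-pred (+ (suc n)) = begin
    pow q n ≈⟨ sym (*-identityˡ _) ⟩
    1# * pow q n ≈⟨ *-congʳ (trans (sym q·qinv≈1) (*-comm q qinv)) ⟩
    (qinv * q) * pow q n ≈⟨ *-assoc qinv q _ ⟩
    qinv * (q * pow q n) ∎
  Q-pred -[1+ n ] = refl

  Q-+ : ∀ x y → Q (x Z.+ y) ≈ Q x * Q y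
  Q-+ (+ zero) y = trans (Q-cong (ZP.+-identityˡ y)) (sym (*-identityˡ _))
  Q-+ (+ (suc m)) y = begin
    Q (+ (suc m) Z.+ y) ≈⟨ Q-cong (ZP.+-assoc (+ 1) (+ m) y) ⟩
    Q (+ 1 Z.+ (+ m Z.+ y)) ≈⟨ Q-suc (+ m Z.+ y) ⟩
    q * Q (+ m Z.+ y) ≈⟨ *-congˡ (Q-+ (+ m) y) ⟩
    q * (pow q m * Q y) ≈⟨ sym (*-assoc _ _ _) ⟩
    (q * pow q m) * Q y ∎
  Q-+ -[1+ zero ] y = trans (Q-pred y) (*-congʳ (sym (*-identityʳ qinv)))
  Q-+ -[1+ (suc m) ] y = begin
    Q (-[1+ (suc m) ] Z.+ y) ≈⟨ Q-cong (ZP.+-assoc -[1+ 0 ] -[1+ m ] y) ⟩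
    Q (-[1+ 0 ] Z.+ (-[1+ m ] Z.+ y)) ≈⟨ Q-pred (-[1+ m ] Z.+ y) ⟩
    qinv * Q (-[1+ m ] Z.+ y) ≈⟨ *-congˡ (Q-+ -[1+ m ] y) ⟩
    qinv * (Q -[1+ m ] * Q y) ≈⟨ sym (*-assoc _ _ _) ⟩
    (qinv * Q -[1+ m ]) * Q y ∎

  Q-inverse : ∀ x → Q x * Q (Z.- x) ≈ 1#
  Q-inverse x = trans (sym (Q-+ x (Z.- x))) (Q-cong (ZP.+-inverseʳ x))

module QBinomialIdentities {c ℓ} (R : CommutativeRing c ℓ)
  (q qinv : CommutativeRing.Carrier R)
  (q·qinv≈1 : CommutativeRing._≈_ R (CommutativeRing._*_ R q qinv) (CommutativeRing.1# R)) where

  open CommutativeRing R hiding (zero)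
  open QDefs R
  open SetoidReasoning setoid
  open NatCoeffSolver commutativeSemiring
  open Sums R
  open QBinomialBasics R q
  open IntegerPowers R q qinv q·qinv≈1

  B : ℕ → ℤ → Carrier
  B = qbinomℤ q

  B-cong : ∀ m {K K'} → K ≡ K' → B m K ≈ B m K'
  B-cong m e = reflexive (P.cong (B m) e)

  B-neg : ∀ m x y → x < y → B m (+ x Z.- + y) ≈ 0#
  B-neg m x y x<y = B-cong m (P.trans (P.cong (λ t → + x Z.- + t) y≡)
                             (P.trans (P.cong (λ t → + x Z.- t) (ZP.pos-+ x (suc d))) (cancel (+ x) (+ d))))
    where
    d = y N.∸ suc x
    y≡ : y ≡ x N.+ suc d
    y≡ = P.trans (P.sym (NP.m+[n∸m]≡n x<y)) (P.sym (NP.+-suc x d))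
    cancel : ∀ a b → a Z.- (a Z.+ (+ 1 Z.+ b)) ≡ Z.- (+ 1 Z.+ b)
    cancel = ZS.solve-∀

  B-shift : ∀ m x d → B m (+ (x N.+ d) Z.- + x) ≈ qb m d
  B-shift m x d = B-cong m (P.trans (P.cong (Z._- + x) (ZP.pos-+ x d)) (cancel (+ x) (+ d)))
    where
    cancel : ∀ a b → (a Z.+ b) Z.- a ≡ b
    cancel = ZS.solve-∀

  B-≥ : ∀ m x y → y ≤ x → B m (+ x Z.- + y) ≈ qb m (x N.∸ y)
  B-≥ m x y y≤x =
    trans (B-cong m (P.cong (λ t → + t Z.- + y) (P.sym (NP.m+[n∸m]≡n y≤x)))) (B-shift m y (x N.∸ y))

  B-diag : ∀ m x → B m (+ x Z.- + x) ≈ 1#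
  B-diag m x = B-cong m (ZP.+-inverseʳ (+ x))

  B-top-zero : ∀ x y → x ≢ y → B 0 (+ x Z.- + y) ≈ 0#
  B-top-zero x y x≢y with NP.<-cmp x y
  ... | Tri.tri< x<y _ _ = B-neg 0 x y x<y
  ... | Tri.tri≈ _ e _ = ⊥-elim (x≢y e)
  ... | Tri.tri> _ _ y<x = trans (B-≥ 0 x y (NP.<⇒≤ y<x)) (qb-zero 0 (x N.∸ y) (NP.m<n⇒0<n∸m y<x))

  pascal : ∀ m K → B (suc m) K ≈ B m (K Z.- + 1) + Q K * B m K
  pascal m (+ zero) = sym (trans (+-identityˡ _) (*-identityˡ _))
  pascal m (+ (suc k)) = refl
  pascal m -[1+ k ] = sym (trans (+-identityˡ _) (zeroʳ _))

  -- The dual q-Pascal rule [N+1,K] = q^(N-K+1) [N,K-1] + [N,K],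
  -- obtained by applying the first rule twice and inducting on N.
  pascal′ : ∀ N K → B (suc N) K ≈ Q (+ N Z.- K Z.+ + 1) * B N (K Z.- + 1) + B N K
  pascal′ zero (+ zero) = sym (trans (+-congʳ (zeroʳ _)) (+-identityˡ _))
  pascal′ zero (+ (suc zero)) = begin
    1# + q * 1# * 0# ≈⟨ trans (+-congˡ (zeroʳ _)) (+-identityʳ _) ⟩
    1# ≈⟨ sym (trans (+-identityʳ _) (*-identityˡ _)) ⟩
    1# * 1# + 0# ∎
  pascal′ zero (+ (suc (suc k))) = trans (+-identityˡ _) (trans (zeroʳ _) (sym (trans (+-identityʳ _) (zeroʳ _))))
  pascal′ zero -[1+ k ] = sym (trans (+-identityʳ _) (zeroʳ _))
  pascal′ (suc N) K = begin
    B (suc (suc N)) K ≈⟨ pascal (suc N) K ⟩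
    B (suc N) (K Z.- + 1) + Q K * B (suc N) K ≈⟨ +-cong (pascal′ N (K Z.- + 1)) (*-congˡ (pascal′ N K)) ⟩
    (Q e * x₂ + x₁) + Q K * (Q (+ N Z.- K Z.+ + 1) * x₁ + x₀)
      ≈⟨ +-congˡ (*-congˡ (+-congʳ (*-congʳ (trans (Q-cong (exp-split (+ N) K)) (Q-+ (e Z.+ K') (Z.- K)))))) ⟩
    (Q e * x₂ + x₁) + Q K * (Q (e Z.+ K') * Q (Z.- K) * x₁ + x₀)
      ≈⟨ solve 7 (λ a b c d f g h → ((a :* b :+ c) :+ d :* (f :* g :* c :+ h))
                    := ((a :* b :+ c) :+ ((d :* g) :* (f :* c) :+ d :* h)))
                  refl (Q e) x₂ x₁ (Q K) (Q (e Z.+ K')) (Q (Z.- K)) x₀ ⟩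
    (Q e * x₂ + x₁) + ((Q K * Q (Z.- K)) * (Q (e Z.+ K') * x₁) + Q K * x₀)
      ≈⟨ +-congˡ (+-congʳ (trans (*-congʳ (Q-inverse K)) (trans (*-identityˡ _) (*-congʳ (Q-+ e K'))))) ⟩
    (Q e * x₂ + x₁) + ((Q e * Q K') * x₁ + Q K * x₀)
      ≈⟨ solve 6 (λ a b c e f g → ((a :* b :+ c) :+ ((a :* e) :* c :+ f)) := (a :* (b :+ e :* c) :+ (c :+ f)))
                  refl (Q e) x₂ x₁ (Q K') (Q K * x₀) x₀ ⟩
    Q e * (x₂ + Q K' * x₁) + (x₁ + Q K * x₀)
      ≈⟨ +-cong (*-cong (Q-cong (exp-shift (+ N) K)) (sym (pascal N K'))) (sym (pascal N K)) ⟩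
    Q (+ suc N Z.- K Z.+ + 1) * B (suc N) K' + B (suc N) K ∎
    where
    K' = K Z.- + 1
    e = + N Z.- K' Z.+ + 1
    x₀ = B N K
    x₁ = B N K'
    x₂ = B N (K' Z.- + 1)
    exp-split : ∀ n k → n Z.- k Z.+ + 1 ≡ (n Z.- (k Z.- + 1) Z.+ + 1) Z.+ (k Z.- + 1) Z.+ (Z.- k)
    exp-split = ZS.solve-∀
    exp-shift : ∀ n k → n Z.- (k Z.- + 1) Z.+ + 1 ≡ (+ 1 Z.+ n) Z.- k Z.+ + 1
    exp-shift = ZS.solve-∀

  qb-sym : ∀ m k → qb (m N.+ k) k ≈ qb (m N.+ k) m
  qb-sym zero k = qb-diag k
  qb-sym (suc m) zero = sym (qb-diag′ (suc m))
  qb-sym (suc m) (suc k) = begin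
    qb (m N.+ suc k) k + pow q (suc k) * qb (m N.+ suc k) (suc k)
      ≈⟨ +-cong (trans (qb-cong-top (NP.+-suc m k) k) (trans (qb-sym (suc m) k) (qb-cong-top (P.sym (NP.+-suc m k)) (suc m))))
                (*-congˡ (qb-sym m (suc k))) ⟩
    qb (m N.+ suc k) (suc m) + pow q (suc k) * qb (m N.+ suc k) m ≈⟨ +-comm _ _ ⟩
    pow q (suc k) * qb (m N.+ suc k) m + qb (m N.+ suc k) (suc m)
      ≈⟨ +-congʳ (*-congʳ (Q-cong (P.sym exponent))) ⟩
    Q (+ (m N.+ suc k) Z.- + suc m Z.+ + 1) * B (m N.+ suc k) (+ suc m Z.- + 1) + B (m N.+ suc k) (+ suc m)
      ≈⟨ sym (pascal′ (m N.+ suc k) (+ suc m)) ⟩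
    qb (suc (m N.+ suc k)) (suc m) ∎
    where
    cancel : ∀ a b → (a Z.+ (+ 1 Z.+ b)) Z.- (+ 1 Z.+ a) Z.+ + 1 ≡ + 1 Z.+ b
    cancel = ZS.solve-∀
    exponent : + (m N.+ suc k) Z.- + suc m Z.+ + 1 ≡ + suc k
    exponent = P.trans (P.cong (λ t → t Z.- + suc m Z.+ + 1) (ZP.pos-+ m (suc k))) (cancel (+ m) (+ k))

  vandermondeTerm : ℕ → ℕ → ℕ → ℕ → Carrier
  vandermondeTerm m p N r = Q ((+ m Z.- + N Z.+ + r) Z.* + r) * (B m (+ N Z.- + r) * qb p r)

  vandermonde : ∀ m p N → sumTo N (vandermondeTerm m p N) ≈ qb (m N.+ p) N
  vandermonde zero p N = begin
    sumTo N (vandermondeTerm 0 p N)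
      ≈⟨ sum-single N N _ NP.≤-refl (λ r r≢N → absorbʳ (absorbˡ (B-top-zero N r (λ e → r≢N (P.sym e))))) ⟩
    Q ((+ 0 Z.- + N Z.+ + N) Z.* + N) * (B 0 (+ N Z.- + N) * qb p N) ≈⟨ *-cong (Q-cong (vanish (+ N))) (*-congʳ (B-diag 0 N)) ⟩
    1# * (1# * qb p N) ≈⟨ trans (*-identityˡ _) (*-identityˡ _) ⟩
    qb p N ∎
    where
    vanish : ∀ n → (+ 0 Z.- n Z.+ n) Z.* n ≡ + 0
    vanish = ZS.solve-∀
  vandermonde (suc m) p N = begin
    sumTo N (vandermondeTerm (suc m) p N) ≈⟨ sum-cong N (λ r _ → split r) ⟩
    sumTo N (λ r → g N r + Q (+ N) * vandermondeTerm m p N r) ≈⟨ sum-+ N (g N) _ ⟩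
    sumTo N (g N) + sumTo N (λ r → Q (+ N) * vandermondeTerm m p N r)
      ≈⟨ +-congˡ (trans (sym (sum-*ˡ N (Q (+ N)) _)) (*-congˡ (vandermonde m p N))) ⟩
    sumTo N (g N) + Q (+ N) * qb (m N.+ p) N ≈⟨ recombine N ⟩
    qb (suc m N.+ p) N ∎
    where
    -- the part of the summand coming from [m, N-r-1] in Pascal's rule
    g : ℕ → ℕ → Carrier
    g N r = Q ((+ suc m Z.- + N Z.+ + r) Z.* + r) * (B m (+ N Z.- + r Z.- + 1) * qb p r)
    split : ∀ r → vandermondeTerm (suc m) p N r ≈ g N r + Q (+ N) * vandermondeTerm m p N r
    split r = begin
      Q e * (B (suc m) K * qb p r) ≈⟨ *-congˡ (*-congʳ (pascal m K)) ⟩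
      Q e * ((B m (K Z.- + 1) + Q K * B m K) * qb p r)
        ≈⟨ solve 5 (λ a b c d f → (a :* ((b :+ c :* d) :* f)) := (a :* (b :* f) :+ (a :* c) :* (d :* f)))
                    refl (Q e) (B m (K Z.- + 1)) (Q K) (B m K) (qb p r) ⟩
      g N r + (Q e * Q K) * (B m K * qb p r)
        ≈⟨ +-congˡ (*-congʳ (trans (sym (Q-+ e K)) (trans (Q-cong (exponent (+ m) (+ N) (+ r))) (Q-+ (+ N) ((+ m Z.- + N Z.+ + r) Z.* + r))))) ⟩
      g N r + (Q (+ N) * Q ((+ m Z.- + N Z.+ + r) Z.* + r)) * (B m K * qb p r) ≈⟨ +-congˡ (*-assoc _ _ _) ⟩
      g N r + Q (+ N) * vandermondeTerm m p N r ∎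
      where
      e = (+ suc m Z.- + N Z.+ + r) Z.* + r
      K = + N Z.- + r
      exponent : ∀ m n r → (+ 1 Z.+ m Z.- n Z.+ r) Z.* r Z.+ (n Z.- r) ≡ n Z.+ (m Z.- n Z.+ r) Z.* r
      exponent = ZS.solve-∀
    -- the g-part is the vandermonde sum for N-1, and Pascal's rule reassembles [m+1+p, N]
    recombine : ∀ N → sumTo N (g N) + Q (+ N) * qb (m N.+ p) N ≈ qb (suc m N.+ p) N
    recombine zero = trans (+-cong (absorbʳ (absorbˡ refl)) (*-identityˡ _)) (+-identityˡ _)
    recombine (suc N) = begin
      (sumTo N (g (suc N)) + g (suc N) (suc N)) + pow q (suc N) * qb (m N.+ p) (suc N)
        ≈⟨ +-congʳ (+-cong (sum-cong N (λ r _ → *-cong (Q-cong (exp-eq (+ m) (+ N) (+ r))) (*-congʳ (B-cong m (idx-eq (+ N) (+ r))))))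
                           (absorbʳ (absorbˡ (B-cong m last-idx)))) ⟩
      (sumTo N (vandermondeTerm m p N) + 0#) + pow q (suc N) * qb (m N.+ p) (suc N)
        ≈⟨ +-congʳ (trans (+-identityʳ _) (vandermonde m p N)) ⟩
      qb (m N.+ p) N + pow q (suc N) * qb (m N.+ p) (suc N) ∎
      where
      exp-eq : ∀ m n r → (+ 1 Z.+ m Z.- (+ 1 Z.+ n) Z.+ r) Z.* r ≡ (m Z.- n Z.+ r) Z.* r
      exp-eq = ZS.solve-∀
      idx-eq : ∀ n r → (+ 1 Z.+ n) Z.- r Z.- + 1 ≡ n Z.- r
      idx-eq = ZS.solve-∀
      last-idx : + suc N Z.- + suc N Z.- + 1 ≡ -[1+ 0 ]
      last-idx = P.cong (Z._- + 1) (ZP.+-inverseʳ (+ suc N))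

  binomPair : ℕ → ℕ → ℕ → ℕ → Carrier
  binomPair n1 n2 i j = qb (n1 N.+ i) j * qb (n2 N.+ j) i

  pairTerm : ℕ → ℕ → ℕ → ℕ → ℕ → Carrier
  pairTerm n1 n2 i j k =
    Q ((+ i Z.- + k) Z.* (+ j Z.- + k)) * (qb (n1 N.+ n2 N.+ k) k * (B n2 (+ i Z.- + k) * B n1 (+ j Z.- + k)))

  pairSum : ℕ → ℕ → ℕ → ℕ → Carrier
  pairSum n1 n2 i j = sumTo i (pairTerm n1 n2 i j)

  pairTerm-vanishesᵢ : ∀ n1 n2 i j k → i < k → pairTerm n1 n2 i j k ≈ 0#
  pairTerm-vanishesᵢ n1 n2 i j k i<k = absorbʳ (absorbʳ (absorbˡ (B-neg n2 i k i<k)))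

  pairTerm-vanishesⱼ : ∀ n1 n2 i j k → j < k → pairTerm n1 n2 i j k ≈ 0#
  pairTerm-vanishesⱼ n1 n2 i j k j<k = absorbʳ (absorbʳ (absorbʳ (B-neg n1 j k j<k)))

  -- [n₂+j, j] [n₂, r] = [j+r, j] [n₂+j, j+r]: trinomial revision, including the
  -- degenerate case r > n₂ where both sides vanish.
  trinomial′ : ∀ n2 j r → qb (n2 N.+ j) j * qb n2 r ≈ qb (j N.+ r) j * qb (n2 N.+ j) (j N.+ r)
  trinomial′ n2 j r with r N.≤? n2
  ... | yes r≤n2 = P.subst (λ t → qb (t N.+ j) j * qb t r ≈ qb (j N.+ r) j * qb (t N.+ j) (j N.+ r))
                           (NP.m+[n∸m]≡n r≤n2) (split (n2 N.∸ r))
    where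
    reorder : ∀ r s j → r N.+ s N.+ j ≡ j N.+ r N.+ s
    reorder = NS.solve-∀
    split : ∀ s → qb (r N.+ s N.+ j) j * qb (r N.+ s) r ≈ qb (j N.+ r) j * qb (r N.+ s N.+ j) (j N.+ r)
    split s = begin
      qb (r N.+ s N.+ j) j * qb (r N.+ s) r ≈⟨ *-congʳ (qb-cong-top (reorder r s j) j) ⟩
      qb (j N.+ r N.+ s) j * qb (r N.+ s) r ≈⟨ sym (trinomial j r s) ⟩
      qb (j N.+ r N.+ s) (j N.+ r) * qb (j N.+ r) j ≈⟨ *-comm _ _ ⟩
      qb (j N.+ r) j * qb (j N.+ r N.+ s) (j N.+ r) ≈⟨ *-congˡ (qb-cong-top (P.sym (reorder r s j)) (j N.+ r)) ⟩
      qb (j N.+ r) j * qb (r N.+ s N.+ j) (j N.+ r) ∎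
  ... | no r≰n2 = trans (absorbʳ (qb-zero n2 r n2<r)) (sym (absorbʳ (qb-zero (n2 N.+ j) (j N.+ r) lt)))
    where
    n2<r = NP.≰⇒> r≰n2
    lt : n2 N.+ j < j N.+ r
    lt = P.subst (_< j N.+ r) (NP.+-comm j n2) (NP.+-monoʳ-< j n2<r)

  -- (★) for n₁ = 0: only the term k = j survives.
  pair-expansion-base : ∀ n2 i j → binomPair 0 n2 i j ≈ pairSum 0 n2 i j
  pair-expansion-base n2 i j with j N.≤? i
  ... | yes j≤i = sym (begin
        pairSum 0 n2 i j
          ≈⟨ sum-single i j _ j≤i (λ k k≢j → absorbʳ (absorbʳ (absorbʳ (B-top-zero j k (λ e → k≢j (P.sym e)))))) ⟩
        pairTerm 0 n2 i j j ≈⟨ *-cong (Q-cong (vanish (+ i) (+ j))) (*-congˡ (*-cong (B-≥ n2 i j j≤i) (B-diag 0 j))) ⟩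
        1# * (qb (n2 N.+ j) j * (qb n2 (i N.∸ j) * 1#)) ≈⟨ trans (*-identityˡ _) (*-congˡ (*-identityʳ _)) ⟩
        qb (n2 N.+ j) j * qb n2 (i N.∸ j) ≈⟨ trinomial′ n2 j (i N.∸ j) ⟩
        qb (j N.+ (i N.∸ j)) j * qb (n2 N.+ j) (j N.+ (i N.∸ j))
          ≈⟨ reflexive (P.cong (λ t → qb t j * qb (n2 N.+ j) t) (NP.m+[n∸m]≡n j≤i)) ⟩
        qb i j * qb (n2 N.+ j) i ∎)
    where
    vanish : ∀ i j → (i Z.- j) Z.* (j Z.- j) ≡ + 0
    vanish = ZS.solve-∀
  ... | no j≰i = trans (absorbˡ (qb-zero i j i<j))
                       (sym (sum-zero i (λ k k≤i → absorbʳ (absorbʳ (absorbʳ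
                          (B-top-zero j k (λ e → NP.<⇒≢ (NP.≤-<-trans k≤i i<j) (P.sym e))))))))
    where
    i<j = NP.≰⇒> j≰i

  -- The recurrence satisfied by both sides of (★), from Pascal's rule.
  binomPair-recurrence : ∀ n1 n2 i j → binomPair (suc n1) n2 (suc i) (suc j) ≈
    binomPair (suc n1) n2 i j + (Q (+ suc i) * binomPair n1 n2 (suc i) j + Q (+ suc j) * binomPair n1 n2 (suc i) (suc j))
  binomPair-recurrence n1 n2 i j = begin
    (A + pow q (suc j) * A') * qb (n2 N.+ suc j) (suc i) ≈⟨ *-congˡ (qb-cong-top (NP.+-suc n2 j) (suc i)) ⟩
    (A + pow q (suc j) * A') * (C + pow q (suc i) * C')
      ≈⟨ solve 6 (λ a a' c c' p r → ((a :+ p :* a') :* (c :+ r :* c')) := (a :* c :+ (r :* (a :* c') :+ p :* (a' :* (c :+ r :* c')))))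
                  refl A A' C C' (pow q (suc j)) (pow q (suc i)) ⟩
    A * C + (pow q (suc i) * (A * C') + pow q (suc j) * (A' * (C + pow q (suc i) * C')))
      ≈⟨ +-cong (*-congʳ (qb-cong-top (NP.+-suc n1 i) j)) (+-congˡ (*-congˡ (*-congˡ (qb-cong-top (P.sym (NP.+-suc n2 j)) (suc i))))) ⟩
    binomPair (suc n1) n2 i j + (Q (+ suc i) * binomPair n1 n2 (suc i) j + Q (+ suc j) * binomPair n1 n2 (suc i) (suc j)) ∎
    where
    A = qb (n1 N.+ suc i) j
    A' = qb (n1 N.+ suc i) (suc j)
    C = qb (n2 N.+ j) i
    C' = qb (n2 N.+ j) (suc i)

  -- The part of pairTerm (n₁+1) n₂ (i+1) (j+1) k coming from [n₁+n₂+k, k-1]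
  -- when Pascal's rule is applied to [n₁+1+n₂+k, k].
  pairTermLower : ℕ → ℕ → ℕ → ℕ → ℕ → Carrier
  pairTermLower n1 n2 i j k =
    Q ((+ suc i Z.- + k) Z.* (+ suc j Z.- + k))
    * (B (n1 N.+ n2 N.+ k) (+ k Z.- + 1) * (B n2 (+ suc i Z.- + k) * B (suc n1) (+ suc j Z.- + k)))

  -- Pascal's rule applied to [n₁+1+n₂+k, k] and then to [n₁+1, j+1-k].
  pairTerm-recurrence : ∀ n1 n2 i j k → pairTerm (suc n1) n2 (suc i) (suc j) k ≈
    pairTermLower n1 n2 i j k + (Q (+ suc i) * pairTerm n1 n2 (suc i) j k + Q (+ suc j) * pairTerm n1 n2 (suc i) (suc j) k)
  pairTerm-recurrence n1 n2 i j k = begin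
    Q e * (B (suc (n1 N.+ n2 N.+ k)) (+ k) * (b₂ * B (suc n1) J)) ≈⟨ *-congˡ (*-congʳ (pascal (n1 N.+ n2 N.+ k) (+ k))) ⟩
    Q e * ((b₋ + Q (+ k) * b₀) * (b₂ * B (suc n1) J))
      ≈⟨ solve 6 (λ qe qk b₀ b₂ b₋ bs → (qe :* ((b₋ :+ qk :* b₀) :* (b₂ :* bs)))
                    := (qe :* (b₋ :* (b₂ :* bs)) :+ (qe :* qk) :* (b₀ :* (b₂ :* bs))))
                  refl (Q e) (Q (+ k)) b₀ b₂ b₋ (B (suc n1) J) ⟩
    pairTermLower n1 n2 i j k + (Q e * Q (+ k)) * (b₀ * (b₂ * B (suc n1) J)) ≈⟨ +-congˡ (*-congˡ (*-congˡ (*-congˡ (pascal n1 J)))) ⟩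
    pairTermLower n1 n2 i j k + (Q e * Q (+ k)) * (b₀ * (b₂ * (B n1 (J Z.- + 1) + Q J * B n1 J)))
      ≈⟨ +-congˡ (solve 6 (λ qq qj b₀ b₂ c₁ c₀ → (qq :* (b₀ :* (b₂ :* (c₁ :+ qj :* c₀))))
                             := (qq :* (b₀ :* (b₂ :* c₁)) :+ (qq :* qj) :* (b₀ :* (b₂ :* c₀))))
                           refl (Q e * Q (+ k)) (Q J) b₀ b₂ (B n1 (J Z.- + 1)) (B n1 J)) ⟩
    pairTermLower n1 n2 i j k + ((Q e * Q (+ k)) * (b₀ * (b₂ * B n1 (J Z.- + 1))) + ((Q e * Q (+ k)) * Q J) * (b₀ * (b₂ * B n1 J)))
      ≈⟨ +-congˡ (+-cong (*-cong exponent₁ (*-congˡ (*-congˡ (B-cong n1 (lower-index (+ j) (+ k)))))) (*-congʳ exponent₂)) ⟩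
    pairTermLower n1 n2 i j k + ((Q (+ suc i) * Q e₁) * (b₀ * (b₂ * B n1 (+ j Z.- + k))) + (Q (+ suc j) * Q e) * (b₀ * (b₂ * B n1 J)))
      ≈⟨ +-congˡ (+-cong (*-assoc _ _ _) (*-assoc _ _ _)) ⟩
    pairTermLower n1 n2 i j k + (Q (+ suc i) * pairTerm n1 n2 (suc i) j k + Q (+ suc j) * pairTerm n1 n2 (suc i) (suc j) k) ∎
    where
    e = (+ suc i Z.- + k) Z.* (+ suc j Z.- + k)
    e₁ = (+ suc i Z.- + k) Z.* (+ j Z.- + k)
    J = + suc j Z.- + k
    b₂ = B n2 (+ suc i Z.- + k)
    b₋ = B (n1 N.+ n2 N.+ k) (+ k Z.- + 1)
    b₀ = qb (n1 N.+ n2 N.+ k) k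
    lower-index : ∀ j k → (+ 1 Z.+ j) Z.- k Z.- + 1 ≡ j Z.- k
    lower-index = ZS.solve-∀
    exp-eq₁ : ∀ i j k → ((+ 1 Z.+ i) Z.- k) Z.* ((+ 1 Z.+ j) Z.- k) Z.+ k ≡ (+ 1 Z.+ i) Z.+ ((+ 1 Z.+ i) Z.- k) Z.* (j Z.- k)
    exp-eq₁ = ZS.solve-∀
    exp-eq₂ : ∀ i j k → ((+ 1 Z.+ i) Z.- k) Z.* ((+ 1 Z.+ j) Z.- k) Z.+ k Z.+ ((+ 1 Z.+ j) Z.- k)
                      ≡ (+ 1 Z.+ j) Z.+ ((+ 1 Z.+ i) Z.- k) Z.* ((+ 1 Z.+ j) Z.- k)
    exp-eq₂ = ZS.solve-∀
    exponent₁ : Q e * Q (+ k) ≈ Q (+ suc i) * Q e₁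
    exponent₁ = trans (sym (Q-+ e (+ k))) (trans (Q-cong (exp-eq₁ (+ i) (+ j) (+ k))) (Q-+ (+ suc i) e₁))
    exponent₂ : (Q e * Q (+ k)) * Q J ≈ Q (+ suc j) * Q e
    exponent₂ = trans (*-congʳ (sym (Q-+ e (+ k))))
                  (trans (sym (Q-+ (e Z.+ + k) J)) (trans (Q-cong (exp-eq₂ (+ i) (+ j) (+ k))) (Q-+ (+ suc j) e)))

  -- The k = 0 term of the lower parts vanishes and the rest is pairSum shifted by one.
  pairTermLower-sum : ∀ n1 n2 i j → sumTo (suc i) (pairTermLower n1 n2 i j) ≈ pairSum (suc n1) n2 i j
  pairTermLower-sum n1 n2 i j = begin
    sumTo (suc i) (pairTermLower n1 n2 i j) ≈⟨ sum-peel i _ ⟩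
    pairTermLower n1 n2 i j 0 + sumTo i (λ k → pairTermLower n1 n2 i j (suc k))
      ≈⟨ +-cong (absorbʳ (absorbˡ refl)) (sum-cong i (λ k _ → shifted k)) ⟩
    0# + pairSum (suc n1) n2 i j ≈⟨ +-identityˡ _ ⟩
    pairSum (suc n1) n2 i j ∎
    where
    drop : ∀ i k → (+ 1 Z.+ i) Z.- (+ 1 Z.+ k) ≡ i Z.- k
    drop = ZS.solve-∀
    shifted : ∀ k → pairTermLower n1 n2 i j (suc k) ≈ pairTerm (suc n1) n2 i j k
    shifted k = *-cong (Q-cong (P.cong₂ Z._*_ (drop (+ i) (+ k)) (drop (+ j) (+ k))))
                  (*-cong (qb-cong-top (NP.+-suc (n1 N.+ n2) k) k)
                          (*-cong (B-cong n2 (drop (+ i) (+ k))) (B-cong (suc n1) (drop (+ j) (+ k)))))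

  pairSum-recurrence : ∀ n1 n2 i j → pairSum (suc n1) n2 (suc i) (suc j) ≈
    pairSum (suc n1) n2 i j + (Q (+ suc i) * pairSum n1 n2 (suc i) j + Q (+ suc j) * pairSum n1 n2 (suc i) (suc j))
  pairSum-recurrence n1 n2 i j = begin
    sumTo (suc i) (pairTerm (suc n1) n2 (suc i) (suc j)) ≈⟨ sum-cong (suc i) (λ k _ → pairTerm-recurrence n1 n2 i j k) ⟩
    sumTo (suc i) (λ k → pairTermLower n1 n2 i j k + (Q (+ suc i) * pairTerm n1 n2 (suc i) j k + Q (+ suc j) * pairTerm n1 n2 (suc i) (suc j) k))
      ≈⟨ trans (sum-+ (suc i) _ _) (+-congˡ (trans (sum-+ (suc i) _ _) (+-cong (sym (sum-*ˡ (suc i) _ _)) (sym (sum-*ˡ (suc i) _ _))))) ⟩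
    sumTo (suc i) (pairTermLower n1 n2 i j) + (Q (+ suc i) * pairSum n1 n2 (suc i) j + Q (+ suc j) * pairSum n1 n2 (suc i) (suc j))
      ≈⟨ +-congʳ (pairTermLower-sum n1 n2 i j) ⟩
    pairSum (suc n1) n2 i j + (Q (+ suc i) * pairSum n1 n2 (suc i) j + Q (+ suc j) * pairSum n1 n2 (suc i) (suc j)) ∎

  pair-expansion : ∀ n1 n2 i j → binomPair n1 n2 i j ≈ pairSum n1 n2 i j
  pair-expansion zero n2 i j = pair-expansion-base n2 i j
  pair-expansion (suc n1) n2 zero j = begin
    qb (suc n1 N.+ 0) j * 1# ≈⟨ trans (*-identityʳ _) (qb-cong-top (NP.+-identityʳ (suc n1)) j) ⟩
    qb (suc n1) j ≈⟨ sym (B-cong (suc n1) (ZP.+-identityʳ (+ j))) ⟩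
    B (suc n1) (+ j Z.- + 0) ≈⟨ sym (trans (*-identityˡ _) (trans (*-identityˡ _) (*-identityˡ _))) ⟩
    1# * (1# * (1# * B (suc n1) (+ j Z.- + 0))) ≈⟨ *-congʳ (Q-cong (P.sym (vanish (+ j)))) ⟩
    pairSum (suc n1) n2 0 j ∎
    where
    vanish : ∀ j → (+ 0 Z.- + 0) Z.* (j Z.- + 0) ≡ + 0
    vanish = ZS.solve-∀
  pair-expansion (suc n1) n2 (suc i) zero = begin
    1# * qb (n2 N.+ 0) (suc i) ≈⟨ trans (*-identityˡ _) (qb-cong-top (NP.+-identityʳ n2) (suc i)) ⟩
    qb n2 (suc i) ≈⟨ sym (B-cong n2 (ZP.+-identityʳ (+ suc i))) ⟩
    B n2 (+ suc i Z.- + 0) ≈⟨ sym (trans (*-identityˡ _) (trans (*-identityˡ _) (*-identityʳ _))) ⟩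
    1# * (1# * (B n2 (+ suc i Z.- + 0) * 1#)) ≈⟨ *-congʳ (Q-cong (P.sym (vanish (+ suc i)))) ⟩
    pairTerm (suc n1) n2 (suc i) 0 0
      ≈⟨ sym (sum-single (suc i) 0 _ z≤n (λ k k≢0 → pairTerm-vanishesⱼ (suc n1) n2 (suc i) 0 k (NP.n≢0⇒n>0 k≢0))) ⟩
    pairSum (suc n1) n2 (suc i) 0 ∎
    where
    vanish : ∀ i → (i Z.- + 0) Z.* (+ 0 Z.- + 0) ≡ + 0
    vanish = ZS.solve-∀
  pair-expansion (suc n1) n2 (suc i) (suc j) = begin
    binomPair (suc n1) n2 (suc i) (suc j) ≈⟨ binomPair-recurrence n1 n2 i j ⟩
    binomPair (suc n1) n2 i j + (Q (+ suc i) * binomPair n1 n2 (suc i) j + Q (+ suc j) * binomPair n1 n2 (suc i) (suc j))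
      ≈⟨ +-cong (pair-expansion (suc n1) n2 i j)
                (+-cong (*-congˡ (pair-expansion n1 n2 (suc i) j)) (*-congˡ (pair-expansion n1 n2 (suc i) (suc j)))) ⟩
    pairSum (suc n1) n2 i j + (Q (+ suc i) * pairSum n1 n2 (suc i) j + Q (+ suc j) * pairSum n1 n2 (suc i) (suc j))
      ≈⟨ sym (pairSum-recurrence n1 n2 i j) ⟩
    pairSum (suc n1) n2 (suc i) (suc j) ∎

  -- Symmetry of the q-multinomial coefficient with four parts.  Writing
  -- (p₁,p₂,p₃,p₄) for the part sizes, it may be computed by first splitting off
  -- p₁+p₃ or p₂+p₃; the two resulting products of binomials agree.

  -- Splitting a+c+b+d as (a+c | b+d) and then each half, versus splitting off a, b, c in turn.
  multinomial-split : ∀ a b c d → qb (a N.+ c N.+ (b N.+ d)) (a N.+ c) * (qb (b N.+ d) b * qb (a N.+ c) a)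
                                ≈ qb (a N.+ (b N.+ (c N.+ d))) a * (qb (b N.+ (c N.+ d)) b * qb (c N.+ d) c)
  multinomial-split a b c d = begin
    qb T (a N.+ c) * (qb (b N.+ d) b * qb (a N.+ c) a) ≈⟨ solve 3 (λ x y z → (x :* (y :* z)) := ((x :* z) :* y)) refl _ _ _ ⟩
    (qb T (a N.+ c) * qb (a N.+ c) a) * qb (b N.+ d) b ≈⟨ *-congʳ (trinomial a c (b N.+ d)) ⟩
    (qb T a * qb (c N.+ (b N.+ d)) c) * qb (b N.+ d) b ≈⟨ *-assoc _ _ _ ⟩
    qb T a * (qb (c N.+ (b N.+ d)) c * qb (b N.+ d) b) ≈⟨ *-congˡ (*-congʳ (qb-cong-top (P.sym (NP.+-assoc c b d)) c)) ⟩
    qb T a * (qb (c N.+ b N.+ d) c * qb (b N.+ d) b) ≈⟨ *-congˡ (sym (trinomial c b d)) ⟩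
    qb T a * (qb (c N.+ b N.+ d) (c N.+ b) * qb (c N.+ b) c)
      ≈⟨ *-congˡ (*-cong (qb-cong (P.cong (N._+ d) cb) cb) (trans (sym (qb-sym c b)) (qb-cong-top cb b))) ⟩
    qb T a * (qb (b N.+ c N.+ d) (b N.+ c) * qb (b N.+ c) b) ≈⟨ *-congˡ (trinomial b c d) ⟩
    qb T a * (qb (b N.+ c N.+ d) b * qb (c N.+ d) c) ≈⟨ *-cong (qb-cong-top (reassoc a b c d) a) (*-congʳ (qb-cong-top (NP.+-assoc b c d) b)) ⟩
    qb (a N.+ (b N.+ (c N.+ d))) a * (qb (b N.+ (c N.+ d)) b * qb (c N.+ d) c) ∎
    where
    T = a N.+ c N.+ (b N.+ d)
    cb : c N.+ b ≡ b N.+ c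
    cb = NP.+-comm c b
    reassoc : ∀ a b c d → a N.+ c N.+ (b N.+ d) ≡ a N.+ (b N.+ (c N.+ d))
    reassoc = NS.solve-∀

  choose-swap : ∀ a b r → qb (a N.+ (b N.+ r)) a * qb (b N.+ r) b ≈ qb (b N.+ (a N.+ r)) b * qb (a N.+ r) a
  choose-swap a b r = begin
    qb (a N.+ (b N.+ r)) a * qb (b N.+ r) b ≈⟨ *-congʳ (qb-cong-top (P.sym (NP.+-assoc a b r)) a) ⟩
    qb (a N.+ b N.+ r) a * qb (b N.+ r) b ≈⟨ sym (trinomial a b r) ⟩
    qb (a N.+ b N.+ r) (a N.+ b) * qb (a N.+ b) a ≈⟨ *-cong (qb-cong (P.cong (N._+ r) ab) ab) (trans (sym (qb-sym a b)) (qb-cong-top ab b)) ⟩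
    qb (b N.+ a N.+ r) (b N.+ a) * qb (b N.+ a) b ≈⟨ trinomial b a r ⟩
    qb (b N.+ a N.+ r) b * qb (a N.+ r) a ≈⟨ *-congʳ (qb-cong-top (NP.+-assoc b a r) b) ⟩
    qb (b N.+ (a N.+ r)) b * qb (a N.+ r) a ∎
    where
    ab = NP.+-comm a b

  multinomial-symmetry : ∀ p₁ p₂ p₃ p₄ →
    qb (p₂ N.+ p₃ N.+ (p₁ N.+ p₄)) (p₁ N.+ p₃) * (qb (p₂ N.+ p₄) p₂ * qb (p₁ N.+ p₃) p₁)
    ≈ qb (p₂ N.+ p₃ N.+ (p₁ N.+ p₄)) (p₂ N.+ p₃) * (qb (p₁ N.+ p₄) p₁ * qb (p₂ N.+ p₃) p₂)
  multinomial-symmetry p₁ p₂ p₃ p₄ = begin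
    qb (p₂ N.+ p₃ N.+ (p₁ N.+ p₄)) (p₁ N.+ p₃) * (qb (p₂ N.+ p₄) p₂ * qb (p₁ N.+ p₃) p₁)
      ≈⟨ *-congʳ (qb-cong-top (reorder p₁ p₂ p₃ p₄) (p₁ N.+ p₃)) ⟩
    qb (p₁ N.+ p₃ N.+ (p₂ N.+ p₄)) (p₁ N.+ p₃) * (qb (p₂ N.+ p₄) p₂ * qb (p₁ N.+ p₃) p₁) ≈⟨ multinomial-split p₁ p₂ p₃ p₄ ⟩
    qb (p₁ N.+ (p₂ N.+ r)) p₁ * (qb (p₂ N.+ r) p₂ * qb r p₃) ≈⟨ sym (*-assoc _ _ _) ⟩
    (qb (p₁ N.+ (p₂ N.+ r)) p₁ * qb (p₂ N.+ r) p₂) * qb r p₃ ≈⟨ *-congʳ (choose-swap p₁ p₂ r) ⟩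
    (qb (p₂ N.+ (p₁ N.+ r)) p₂ * qb (p₁ N.+ r) p₁) * qb r p₃ ≈⟨ *-assoc _ _ _ ⟩
    qb (p₂ N.+ (p₁ N.+ r)) p₂ * (qb (p₁ N.+ r) p₁ * qb r p₃) ≈⟨ sym (multinomial-split p₂ p₁ p₃ p₄) ⟩
    qb (p₂ N.+ p₃ N.+ (p₁ N.+ p₄)) (p₂ N.+ p₃) * (qb (p₁ N.+ p₄) p₁ * qb (p₂ N.+ p₃) p₂) ∎
    where
    r = p₃ N.+ p₄
    reorder : ∀ p₁ p₂ p₃ p₄ → p₂ N.+ p₃ N.+ (p₁ N.+ p₄) ≡ p₁ N.+ p₃ N.+ (p₂ N.+ p₄)
    reorder = NS.solve-∀

  -- The same symmetry with the parts given implicitly by  n₁' + p₂ = n₁ + p₁  and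
  -- n₂' + p₁ = n₂ + p₂; when a part would be negative both sides vanish.
  multinomial-symmetry′ : ∀ n1 n2 n1' n2' p₁ p₂ → n1' N.+ p₂ ≡ n1 N.+ p₁ → n2' N.+ p₁ ≡ n2 N.+ p₂ →
    qb (n1 N.+ n2) n1' * (qb n2' p₂ * qb n1' p₁) ≈ qb (n1 N.+ n2) n1 * (qb n2 p₁ * qb n1 p₂)
  multinomial-symmetry′ n1 n2 n1' n2' p₁ p₂ e₁ e₂ with p₁ N.≤? n1' | p₂ N.≤? n2'
  ... | no p₁≰ | _ = trans (absorbʳ (absorbʳ (qb-zero n1' p₁ n1'<p₁))) (sym (absorbʳ (absorbʳ (qb-zero n1 p₂ lt))))
    where
    n1'<p₁ = NP.≰⇒> p₁≰
    lt : n1 < p₂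
    lt = NP.+-cancelʳ-< p₁ n1 p₂ (P.subst (_< p₂ N.+ p₁) e₁ (P.subst (n1' N.+ p₂ <_) (NP.+-comm p₁ p₂) (NP.+-monoˡ-< p₂ n1'<p₁)))
  ... | yes _ | no p₂≰ = trans (absorbʳ (absorbˡ (qb-zero n2' p₂ n2'<p₂))) (sym (absorbʳ (absorbˡ (qb-zero n2 p₁ lt))))
    where
    n2'<p₂ = NP.≰⇒> p₂≰
    lt : n2 < p₁
    lt = NP.+-cancelʳ-< p₂ n2 p₁ (P.subst (_< p₁ N.+ p₂) e₂ (P.subst (n2' N.+ p₁ <_) (NP.+-comm p₂ p₁) (NP.+-monoˡ-< p₁ n2'<p₂)))
  ... | yes p₁≤ | yes p₂≤ = instantiate (P.sym (NP.m+[n∸m]≡n p₁≤)) (P.sym (NP.m+[n∸m]≡n p₂≤)) n1≡ n2≡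
    where
    p₃ = n1' N.∸ p₁
    p₄ = n2' N.∸ p₂
    instantiate : ∀ {n1 n2 n1' n2'} → n1' ≡ p₁ N.+ p₃ → n2' ≡ p₂ N.+ p₄ → n1 ≡ p₂ N.+ p₃ → n2 ≡ p₁ N.+ p₄ →
      qb (n1 N.+ n2) n1' * (qb n2' p₂ * qb n1' p₁) ≈ qb (n1 N.+ n2) n1 * (qb n2 p₁ * qb n1 p₂)
    instantiate P.refl P.refl P.refl P.refl = multinomial-symmetry p₁ p₂ p₃ p₄
    swap-ends : ∀ a b c → a N.+ c N.+ b ≡ b N.+ c N.+ a
    swap-ends = NS.solve-∀
    n1≡ : n1 ≡ p₂ N.+ p₃
    n1≡ = NP.+-cancelʳ-≡ p₁ n1 (p₂ N.+ p₃)
            (P.trans (P.sym e₁) (P.trans (P.cong (N._+ p₂) (P.sym (NP.m+[n∸m]≡n p₁≤))) (swap-ends p₁ p₂ p₃)))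
    n2≡ : n2 ≡ p₁ N.+ p₄
    n2≡ = NP.+-cancelʳ-≡ p₂ n2 (p₁ N.+ p₄)
            (P.trans (P.sym e₂) (P.trans (P.cong (N._+ p₁) (P.sym (NP.m+[n∸m]≡n p₂≤))) (swap-ends p₂ p₁ p₄)))

  -- Away from the vanishing cases this is the multinomial symmetry with parts
  -- i-k, j-k, n₁-j+k, n₂-i+k.
  pairTerm-exchange : ∀ n1 n2 n1' n2' i j k → n1' N.+ j ≡ n1 N.+ i → n2' N.+ i ≡ n2 N.+ j →
    qb (n1 N.+ n2) n1' * pairTerm n1' n2' j i k ≈ qb (n1 N.+ n2) n1 * pairTerm n1 n2 i j k
  pairTerm-exchange n1 n2 n1' n2' i j k e₁ e₂ with k N.≤? i | k N.≤? j
  ... | no k≰i | _ = trans (absorbʳ (pairTerm-vanishesⱼ n1' n2' j i k i<k)) (sym (absorbʳ (pairTerm-vanishesᵢ n1 n2 i j k i<k)))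
    where i<k = NP.≰⇒> k≰i
  ... | yes _ | no k≰j = trans (absorbʳ (pairTerm-vanishesᵢ n1' n2' j i k j<k)) (sym (absorbʳ (pairTerm-vanishesⱼ n1 n2 i j k j<k)))
    where j<k = NP.≰⇒> k≰j
  ... | yes k≤i | yes k≤j = begin
    qb n n1' * (Q (E j i) * (qb (n1' N.+ n2' N.+ k) k * (B n2' (+ j Z.- + k) * B n1' (+ i Z.- + k))))
      ≈⟨ *-congˡ (*-cong (Q-cong (ZP.*-comm (+ j Z.- + k) (+ i Z.- + k)))
                         (*-cong (qb-cong-top (P.cong (N._+ k) same-total) k) (*-cong (B-≥ n2' j k k≤j) (B-≥ n1' i k k≤i)))) ⟩
    qb n n1' * (Q (E i j) * (qb (n N.+ k) k * (qb n2' p₂ * qb n1' p₁)))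
      ≈⟨ solve 4 (λ a b c d → (a :* (b :* (c :* d))) := ((b :* c) :* (a :* d))) refl _ _ _ _ ⟩
    (Q (E i j) * qb (n N.+ k) k) * (qb n n1' * (qb n2' p₂ * qb n1' p₁))
      ≈⟨ *-congˡ (multinomial-symmetry′ n1 n2 n1' n2' p₁ p₂ parts₁ parts₂) ⟩
    (Q (E i j) * qb (n N.+ k) k) * (qb n n1 * (qb n2 p₁ * qb n1 p₂))
      ≈⟨ solve 4 (λ a b c d → ((b :* c) :* (a :* d)) := (a :* (b :* (c :* d)))) refl _ _ _ _ ⟩
    qb n n1 * (Q (E i j) * (qb (n N.+ k) k * (qb n2 p₁ * qb n1 p₂)))
      ≈⟨ *-congˡ (*-congˡ (*-congˡ (sym (*-cong (B-≥ n2 i k k≤i) (B-≥ n1 j k k≤j))))) ⟩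
    qb n n1 * pairTerm n1 n2 i j k ∎
    where
    n = n1 N.+ n2
    E : ℕ → ℕ → ℤ
    E x y = (+ x Z.- + k) Z.* (+ y Z.- + k)
    p₁ = i N.∸ k
    p₂ = j N.∸ k
    i≡ = P.sym (NP.m+[n∸m]≡n k≤i)
    j≡ = P.sym (NP.m+[n∸m]≡n k≤j)
    cancel-k : ∀ a b c d k → a N.+ (k N.+ c) ≡ b N.+ (k N.+ d) → a N.+ c ≡ b N.+ d
    cancel-k a b c d k e = NP.+-cancelʳ-≡ k (a N.+ c) (b N.+ d) (P.trans (shuffle a c k) (P.trans e (P.sym (shuffle b d k))))
      where
      shuffle : ∀ x y z → x N.+ y N.+ z ≡ x N.+ (z N.+ y)
      shuffle = NS.solve-∀
    add-cancel : ∀ a b c d i j → a N.+ j ≡ c N.+ i → b N.+ i ≡ d N.+ j → a N.+ b ≡ c N.+ d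
    add-cancel a b c d i j f₁ f₂ = NP.+-cancelʳ-≡ (i N.+ j) (a N.+ b) (c N.+ d)
      (P.trans (shuffle₁ a b i j) (P.trans (P.cong₂ N._+_ f₁ f₂) (shuffle₂ c d i j)))
      where
      shuffle₁ : ∀ a b i j → a N.+ b N.+ (i N.+ j) ≡ a N.+ j N.+ (b N.+ i)
      shuffle₁ = NS.solve-∀
      shuffle₂ : ∀ c d i j → c N.+ i N.+ (d N.+ j) ≡ c N.+ d N.+ (i N.+ j)
      shuffle₂ = NS.solve-∀
    same-total : n1' N.+ n2' ≡ n1 N.+ n2
    same-total = add-cancel n1' n2' n1 n2 i j e₁ e₂
    parts₁ : n1' N.+ p₂ ≡ n1 N.+ p₁
    parts₁ = cancel-k n1' n1 p₂ p₁ k (P.trans (P.cong (n1' N.+_) (P.sym j≡)) (P.trans e₁ (P.cong (n1 N.+_) i≡)))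
    parts₂ : n2' N.+ p₁ ≡ n2 N.+ p₂
    parts₂ = cancel-k n2' n2 p₁ p₂ k (P.trans (P.cong (n2' N.+_) (P.sym i≡)) (P.trans e₂ (P.cong (n2 N.+_) j≡)))

  -- With n₁' = n₁+i-j, n₂' = n₂+j-i the left side is [n, n₁'] times binomPair n₁' n₂' j i;
  -- expand it by (★) and exchange the summands.
  shifted-pair-expansion : ∀ n1 n2 i j →
    B (n1 N.+ n2) (+ n1 Z.+ + i Z.- + j) * (qb (n1 N.+ i) n1 * qb (n2 N.+ j) n2) ≈ qb (n1 N.+ n2) n1 * pairSum n1 n2 i j
  shifted-pair-expansion n1 n2 i j with j N.≤? n1 N.+ i | i N.≤? n2 N.+ j
  ... | no j≰ | _ = trans (absorbˡ (B-neg n (n1 N.+ i) j n1+i<j)) (sym (absorbʳ (trans (sym (pair-expansion n1 n2 i j)) (absorbˡ (qb-zero (n1 N.+ i) j n1+i<j)))))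
    where
    n = n1 N.+ n2
    n1+i<j = NP.≰⇒> j≰
  ... | yes j≤ | no i≰ = trans (absorbˡ (trans (B-≥ n (n1 N.+ i) j j≤) (qb-zero n d n<d)))
                               (sym (absorbʳ (trans (sym (pair-expansion n1 n2 i j)) (absorbʳ (qb-zero (n2 N.+ j) i (NP.≰⇒> i≰))))))
    where
    n = n1 N.+ n2
    d = n1 N.+ i N.∸ j
    n<d : n < d
    n<d = NP.+-cancelʳ-< j n d (P.subst₂ _<_ (P.sym (NP.+-assoc n1 n2 j)) (P.trans (P.sym (NP.m+[n∸m]≡n j≤)) (NP.+-comm j d))
                                                  (NP.+-monoʳ-< n1 (NP.≰⇒> i≰)))
  ... | yes j≤ | yes i≤ = begin
    B n (+ n1 Z.+ + i Z.- + j) * (qb (n1 N.+ i) n1 * qb (n2 N.+ j) n2)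
      ≈⟨ *-cong (B-≥ n (n1 N.+ i) j j≤) (*-cong (trans (sym (qb-sym n1 i)) (qb-cong-top (P.sym e₁) i))
                                                (trans (sym (qb-sym n2 j)) (qb-cong-top (P.sym e₂) j))) ⟩
    qb n n1' * binomPair n1' n2' j i ≈⟨ *-congˡ (pair-expansion n1' n2' j i) ⟩
    qb n n1' * pairSum n1' n2' j i ≈⟨ sum-*ˡ j (qb n n1') _ ⟩
    sumTo j (λ k → qb n n1' * pairTerm n1' n2' j i k)
      ≈⟨ sym (sum-extend j i _ (λ k j<k → absorbʳ (pairTerm-vanishesᵢ n1' n2' j i k j<k))) ⟩
    sumTo (j N.+ i) (λ k → qb n n1' * pairTerm n1' n2' j i k)
      ≈⟨ sum-cong (j N.+ i) (λ k _ → pairTerm-exchange n1 n2 n1' n2' i j k e₁ e₂) ⟩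
    sumTo (j N.+ i) (λ k → qb n n1 * pairTerm n1 n2 i j k) ≈⟨ reflexive (P.cong (λ t → sumTo t (λ k → qb n n1 * pairTerm n1 n2 i j k)) (NP.+-comm j i)) ⟩
    sumTo (i N.+ j) (λ k → qb n n1 * pairTerm n1 n2 i j k)
      ≈⟨ sum-extend i j _ (λ k i<k → absorbʳ (pairTerm-vanishesᵢ n1 n2 i j k i<k)) ⟩
    sumTo i (λ k → qb n n1 * pairTerm n1 n2 i j k) ≈⟨ sym (sum-*ˡ i (qb n n1) _) ⟩
    qb n n1 * pairSum n1 n2 i j ∎
    where
    n = n1 N.+ n2
    n1' = n1 N.+ i N.∸ j
    n2' = n2 N.+ j N.∸ i
    e₁ : n1' N.+ j ≡ n1 N.+ i
    e₁ = P.trans (NP.+-comm n1' j) (NP.m+[n∸m]≡n j≤)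
    e₂ : n2' N.+ i ≡ n2 N.+ j
    e₂ = P.trans (NP.+-comm n2' i) (NP.m+[n∸m]≡n i≤)

  -- q-Vandermonde in the shifted form in which it appears after separating the sums:
  --   Σ_{i ≤ a} q^{(n₁-a+i)(i-k)} [n₁, a-i] [n₂, i-k] = [n₁+n₂, a-k].
  convolutionTerm : ℕ → ℕ → ℕ → ℕ → ℕ → Carrier
  convolutionTerm n1 n2 a k i = Q ((+ n1 Z.- + a Z.+ + i) Z.* (+ i Z.- + k)) * (B n1 (+ a Z.- + i) * B n2 (+ i Z.- + k))

  shifted-vandermonde : ∀ n1 n2 a k → sumTo a (convolutionTerm n1 n2 a k) ≈ B (n1 N.+ n2) (+ a Z.- + k)
  shifted-vandermonde n1 n2 a k with k N.≤? a
  ... | yes k≤a = P.subst (λ t → sumTo t (convolutionTerm n1 n2 t k) ≈ B (n1 N.+ n2) (+ t Z.- + k)) (NP.m+[n∸m]≡n k≤a)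
                    (trans (reindexed (a N.∸ k)) (sym (B-shift (n1 N.+ n2) k (a N.∸ k))))
    where
    exp-eq : ∀ n1 k N r → (n1 Z.- (k Z.+ N) Z.+ (k Z.+ r)) Z.* ((k Z.+ r) Z.- k) ≡ (n1 Z.- N Z.+ r) Z.* r
    exp-eq = ZS.solve-∀
    idx-eq : ∀ k N r → (k Z.+ N) Z.- (k Z.+ r) ≡ N Z.- r
    idx-eq = ZS.solve-∀
    -- the terms with i < k vanish; i = k + r gives the r-th Vandermonde term
    reindexed : ∀ N → sumTo (k N.+ N) (convolutionTerm n1 n2 (k N.+ N) k) ≈ qb (n1 N.+ n2) N
    reindexed N = begin
      sumTo (k N.+ N) (convolutionTerm n1 n2 (k N.+ N) k)
        ≈⟨ sum-shift k N _ (λ i i<k → absorbʳ (absorbʳ (B-neg n2 i k i<k))) ⟩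
      sumTo N (λ r → convolutionTerm n1 n2 (k N.+ N) k (k N.+ r))
        ≈⟨ sum-cong N (λ r _ → *-cong (Q-cong (P.trans (P.cong₂ (λ x y → (+ n1 Z.- x Z.+ y) Z.* (y Z.- + k)) (ZP.pos-+ k N) (ZP.pos-+ k r))
                                                          (exp-eq (+ n1) (+ k) (+ N) (+ r))))
                                      (*-cong (B-cong n1 (P.trans (P.cong₂ Z._-_ (ZP.pos-+ k N) (ZP.pos-+ k r)) (idx-eq (+ k) (+ N) (+ r))))
                                              (B-shift n2 k r))) ⟩
      sumTo N (vandermondeTerm n1 n2 N) ≈⟨ vandermonde n1 n2 N ⟩
      qb (n1 N.+ n2) N ∎
  ... | no k≰a = trans (sum-zero a (λ i i≤a → absorbʳ (absorbʳ (B-neg n2 i k (NP.≤-<-trans i≤a a<k)))))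
                       (sym (B-neg (n1 N.+ n2) a k a<k))
    where
    a<k = NP.≰⇒> k≰a

  module Reorganisation (n1 n2 a b : ℕ) where

    n : ℕ
    n = n1 N.+ n2

    lhsExponent : ℕ → ℕ → ℤ
    lhsExponent i j = (+ n1 Z.- + a) Z.* + i Z.+ (+ n2 Z.- + b) Z.* + j Z.- + i Z.* + j Z.+ + i Z.* + i Z.+ + j Z.* + j

    rhsExponent : ℕ → ℤ
    rhsExponent k = (+ n Z.- + a Z.- + b) Z.* + k Z.+ + k Z.* + k

    -- the summand of the triple sum obtained by expanding the (i,j) summand of the left side
    tripleTerm : ℕ → ℕ → ℕ → Carrier
    tripleTerm i j k = (Q (lhsExponent i j) * (B n1 (+ a Z.- + i) * B n2 (+ b Z.- + j))) * pairTerm n1 n2 i j k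

    rhsTerm : ℕ → Carrier
    rhsTerm k = Q (rhsExponent k) * (qb (n N.+ k) k * (B n (+ a Z.- + k) * B n (+ b Z.- + k)))

    lhs-summand-expansion : ∀ i j → i ≤ a →
      Q (lhsExponent i j) * (B n1 (+ a Z.- + i) * (B n2 (+ b Z.- + j) * (B n (+ n1 Z.+ + i Z.- + j) * (qb (n1 N.+ i) n1 * qb (n2 N.+ j) n2))))
      ≈ qb n n1 * sumTo a (tripleTerm i j)
    lhs-summand-expansion i j i≤a = begin
      qe * (ba * (bb * (B n (+ n1 Z.+ + i Z.- + j) * (qb (n1 N.+ i) n1 * qb (n2 N.+ j) n2))))
        ≈⟨ *-congˡ (*-congˡ (*-congˡ (shifted-pair-expansion n1 n2 i j))) ⟩
      qe * (ba * (bb * (qb n n1 * pairSum n1 n2 i j)))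
        ≈⟨ *-congˡ (*-congˡ (*-congˡ (*-congˡ (sym (sum-extend≤ i a _ i≤a (pairTerm-vanishesᵢ n1 n2 i j)))))) ⟩
      qe * (ba * (bb * (qb n n1 * sumTo a (pairTerm n1 n2 i j))))
        ≈⟨ solve 5 (λ x y z c s → (x :* (y :* (z :* (c :* s)))) := (c :* ((x :* (y :* z)) :* s))) refl qe ba bb (qb n n1) _ ⟩
      qb n n1 * ((qe * (ba * bb)) * sumTo a (pairTerm n1 n2 i j)) ≈⟨ *-congˡ (sum-*ˡ a _ _) ⟩
      qb n n1 * sumTo a (tripleTerm i j) ∎
      where
      qe = Q (lhsExponent i j)
      ba = B n1 (+ a Z.- + i)
      bb = B n2 (+ b Z.- + j)

    tripleTerm-factorisation : ∀ i j k →
      tripleTerm i j k ≈ (Q (rhsExponent k) * qb (n N.+ k) k) * (convolutionTerm n1 n2 a k i * convolutionTerm n2 n1 b k j)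
    tripleTerm-factorisation i j k = begin
      (qe * (ba * bb)) * (Q eₖ * (qbk * (b₂ * b₁)))
        ≈⟨ solve 7 (λ qe ba bb qs qbk b₂ b₁ → ((qe :* (ba :* bb)) :* (qs :* (qbk :* (b₂ :* b₁))))
                      := ((qe :* qs) :* (qbk :* ((ba :* b₂) :* (bb :* b₁)))))
                    refl qe ba bb (Q eₖ) qbk b₂ b₁ ⟩
      (qe * Q eₖ) * (qbk * ((ba * b₂) * (bb * b₁)))
        ≈⟨ *-congʳ (trans (sym (Q-+ (lhsExponent i j) eₖ)) (trans (Q-cong exponent) (trans (Q-+ (rhsExponent k) _) (*-congˡ (Q-+ eA eB))))) ⟩
      (Q (rhsExponent k) * (Q eA * Q eB)) * (qbk * ((ba * b₂) * (bb * b₁)))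
        ≈⟨ solve 6 (λ qk qa qb' qbk x y → ((qk :* (qa :* qb')) :* (qbk :* (x :* y))) := ((qk :* qbk) :* ((qa :* x) :* (qb' :* y))))
                    refl (Q (rhsExponent k)) (Q eA) (Q eB) qbk (ba * b₂) (bb * b₁) ⟩
      (Q (rhsExponent k) * qbk) * ((Q eA * (ba * b₂)) * (Q eB * (bb * b₁))) ∎
      where
      qe = Q (lhsExponent i j)
      ba = B n1 (+ a Z.- + i)
      bb = B n2 (+ b Z.- + j)
      eₖ = (+ i Z.- + k) Z.* (+ j Z.- + k)
      qbk = qb (n N.+ k) k
      b₂ = B n2 (+ i Z.- + k)
      b₁ = B n1 (+ j Z.- + k)
      eA = (+ n1 Z.- + a Z.+ + i) Z.* (+ i Z.- + k)
      eB = (+ n2 Z.- + b Z.+ + j) Z.* (+ j Z.- + k)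
      exp-eq : ∀ n1 n2 a b i j k →
        ((n1 Z.- a) Z.* i Z.+ (n2 Z.- b) Z.* j Z.- i Z.* j Z.+ i Z.* i Z.+ j Z.* j) Z.+ (i Z.- k) Z.* (j Z.- k)
        ≡ ((n1 Z.+ n2) Z.- a Z.- b) Z.* k Z.+ k Z.* k Z.+ ((n1 Z.- a Z.+ i) Z.* (i Z.- k) Z.+ (n2 Z.- b Z.+ j) Z.* (j Z.- k))
      exp-eq = ZS.solve-∀
      exponent : lhsExponent i j Z.+ eₖ ≡ rhsExponent k Z.+ (eA Z.+ eB)
      exponent = P.trans (exp-eq (+ n1) (+ n2) (+ a) (+ b) (+ i) (+ j) (+ k))
                         (P.cong (λ t → (t Z.- + a Z.- + b) Z.* + k Z.+ + k Z.* + k Z.+ (eA Z.+ eB)) (P.sym (ZP.pos-+ n1 n2)))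

    -- Hence the double sum over i and j separates into two q-Vandermonde sums.
    separated-sum : ∀ k → sumTo a (λ i → sumTo b (λ j → tripleTerm i j k)) ≈ rhsTerm k
    separated-sum k = begin
      sumTo a (λ i → sumTo b (λ j → tripleTerm i j k))
        ≈⟨ sum-cong a (λ i _ → sum-cong b (λ j _ → trans (tripleTerm-factorisation i j k) (sym (*-assoc _ _ _)))) ⟩
      sumTo a (λ i → sumTo b (λ j → (κ * α i) * β j)) ≈⟨ sum-cong a (λ i _ → sym (sum-*ˡ b _ β)) ⟩
      sumTo a (λ i → (κ * α i) * sumTo b β) ≈⟨ sym (sum-*ʳ a _ _) ⟩
      sumTo a (λ i → κ * α i) * sumTo b β ≈⟨ *-congʳ (sym (sum-*ˡ a κ α)) ⟩
      (κ * sumTo a α) * sumTo b β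
        ≈⟨ *-cong (*-congˡ (shifted-vandermonde n1 n2 a k))
                  (trans (shifted-vandermonde n2 n1 b k) (reflexive (P.cong (λ t → B t (+ b Z.- + k)) (NP.+-comm n2 n1)))) ⟩
      (κ * B n (+ a Z.- + k)) * B n (+ b Z.- + k) ≈⟨ trans (*-assoc _ _ _) (*-assoc _ _ _) ⟩
      rhsTerm k ∎
      where
      κ = Q (rhsExponent k) * qb (n N.+ k) k
      α = convolutionTerm n1 n2 a k
      β = convolutionTerm n2 n1 b k

    rhsTerm-vanishes : ∀ k → a ⊓ b < k → rhsTerm k ≈ 0#
    rhsTerm-vanishes k lt with k N.≤? a | k N.≤? b
    ... | no k≰a | _ = absorbʳ (absorbʳ (absorbˡ (B-neg n a k (NP.≰⇒> k≰a))))
    ... | yes _ | no k≰b = absorbʳ (absorbʳ (absorbʳ (B-neg n b k (NP.≰⇒> k≰b))))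
    ... | yes k≤a | yes k≤b = ⊥-elim (NP.<⇒≱ lt (NP.⊓-glb k≤a k≤b))

proposition5p1 : ∀ {c ℓ} (R : CommutativeRing c ℓ)
    (q qinv : CommutativeRing.Carrier R) →
    CommutativeRing._≈_ R (CommutativeRing._*_ R q qinv) (CommutativeRing.1# R) →
    (n₁ n₂ a b : ℕ) →
    CommutativeRing._≈_ R (QDefs.lhs5p1 R q qinv n₁ n₂ a b) (QDefs.rhs5p1 R q qinv n₁ n₂ a b)
proposition5p1 R q qinv q·qinv≈1 n₁ n₂ a b = begin
  lhs5p1 q qinv n₁ n₂ a b
    ≈⟨ sum-cong a (λ i i≤a → sum-cong b (λ j _ → lhs-summand-expansion i j i≤a)) ⟩
  sumTo a (λ i → sumTo b (λ j → qb n n₁ * sumTo a (tripleTerm i j)))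
    ≈⟨ sym (trans (sum-*ˡ a _ _) (sum-cong a (λ i _ → sum-*ˡ b _ _))) ⟩
  qb n n₁ * sumTo a (λ i → sumTo b (λ j → sumTo a (tripleTerm i j)))
    ≈⟨ *-congˡ (trans (sum-cong a (λ i _ → sum-swap b a (tripleTerm i))) (sum-swap a a _)) ⟩
  qb n n₁ * sumTo a (λ k → sumTo a (λ i → sumTo b (λ j → tripleTerm i j k)))
    ≈⟨ *-congˡ (sum-cong a (λ k _ → separated-sum k)) ⟩
  qb n n₁ * sumTo a rhsTerm
    ≈⟨ *-congˡ (sum-extend≤ (a ⊓ b) a rhsTerm (NP.m⊓n≤m a b) rhsTerm-vanishes) ⟩
  rhs5p1 q qinv n₁ n₂ a b ∎
  where
  open CommutativeRing R hiding (zero)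
  open QDefs R
  open SetoidReasoning setoid
  open Sums R
  open QBinomialBasics R q
  open QBinomialIdentities R q qinv q·qinv≈1
  open Reorganisation n₁ n₂ a b
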